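{- There is a formula $\phi\in\mathcal{D}({\sf M})$ containing no dependence atoms such that $\phi$ is not $k$-coherent for any $k\in\mathbb{N}$.
   Context: A formula $\phi$ is $k$-coherent iff for all finite structures ${\mathfrak A}$ and teams $X$: ${\mathfrak A}\models_X\phi$ iff ${\mathfrak A}\models_{X'}\phi$ for every $k$-element subteam $X'\subseteq X$. Dependence logic $\mathcal{D}$: formulas in negation normal form built from first-order literals, dependence atoms $=\!\!(t_1,\ldots,t_n)$ and their negations, using $\wedge,\vee,\exists x,\forall x$. A team $X$ of $A$ is a set of assignments from a common finite set of variables into $A$. For $F:X\to A$, $X(F/x)=\{s(F(s)/x):s\in X\}$, $X(A/x)=\{s(a/x):s\in X,a\in A\}$. Satisfaction ${\mathfrak A}\models_X\phi$: a first-order literal holds iff it holds under every $s\in X$; $=\!\!(t_1,\ldots,t_n)$ holds iff any $s,s'\in X$ agreeing on the values of $t_1,\ldots,t_{n-1}$ agree on $t_n$; $\neg=\!\!(\ldots)$ holds iff $X=\emptyset$; $\wedge$ conjunction; $\psi\vee\chi$ iff $X=Y\cup Z$ with $\psi$ in $Y$, $\chi$ in $Z$; $\exists x\psi$ iff $\psi$ holds in $X(F/x)$ for some $F:X\to A$; $\forall x\psi$ iff $\psi$ holds in $X(A/x)$; ${\mathfrak A}\models_X{\sf M}x\psi$ iff for at least $|A|^{|X|}/2$ many $F:X\to A$, ${\mathfrak A}\models_{X(F/x)}\psi$. $\mathcal{D}({\sf M})$ is $\mathcal{D}$ extended by ${\sf M}$. -}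

module Defs where

open import Data.Nat using (ℕ; zero; suc; _*_; _^_; _≤ᵇ_)
open import Data.Bool using (Bool; true; false; _∧_; _∨_; not)
open import Data.Fin using (Fin; zero; suc)
import Data.Fin as F
open import Data.List as L using (List; []; _∷_; length)
open import Data.Vec as V using (Vec; []; _∷_)
open import Data.Vec.Properties using (≡-dec)
open import Data.Bool.ListAction using () renaming (any to anyᵇ; all to allᵇ)
open import Data.Product using (_×_; proj₁; proj₂)
open import Relation.Nullary using (¬_)
open import Relation.Nullary.Decidable using (⌊_⌋)
open import Relation.Binary.PropositionalEquality using (_≡_)
open import Function.Bundles using (_⇔_)

record Vocabulary : Set where
  field
    funArities : List ℕ
    relArities : List ℕ

FunSym : Vocabulary → Set
FunSym τ = Fin (length (Vocabulary.funArities τ))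

RelSym : Vocabulary → Set
RelSym τ = Fin (length (Vocabulary.relArities τ))

funAr : (τ : Vocabulary) → FunSym τ → ℕ
funAr τ = L.lookup (Vocabulary.funArities τ)

relAr : (τ : Vocabulary) → RelSym τ → ℕ
relAr τ = L.lookup (Vocabulary.relArities τ)

data Term (τ : Vocabulary) (d : ℕ) : Set where
  var : Fin d → Term τ d
  app : (f : FunSym τ) → Vec (Term τ d) (funAr τ f) → Term τ d

-- Formulas of D(M) in negation normal form.
data Formula (τ : Vocabulary) (d : ℕ) : Set where
  eq   : Term τ d → Term τ d → Formula τ d
  neq  : Term τ d → Term τ d → Formula τ d
  rel  : (R : RelSym τ) → Vec (Term τ d) (relAr τ R) → Formula τ d
  nrel : (R : RelSym τ) → Vec (Term τ d) (relAr τ R) → Formula τ d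
  dep  : List (Term τ d) → Term τ d → Formula τ d
  ndep : List (Term τ d) → Term τ d → Formula τ d
  and  : Formula τ d → Formula τ d → Formula τ d
  or   : Formula τ d → Formula τ d → Formula τ d
  ex   : Fin d → Formula τ d → Formula τ d
  all  : Fin d → Formula τ d → Formula τ d
  most : Fin d → Formula τ d → Formula τ d

data NoDep {τ : Vocabulary} {d : ℕ} : Formula τ d → Set where
  eq   : ∀ t u → NoDep (eq t u)
  neq  : ∀ t u → NoDep (neq t u)
  rel  : ∀ R ts → NoDep (rel R ts)
  nrel : ∀ R ts → NoDep (nrel R ts)
  and  : ∀ {φ ψ} → NoDep φ → NoDep ψ → NoDep (and φ ψ)
  or   : ∀ {φ ψ} → NoDep φ → NoDep ψ → NoDep (or φ ψ)
  ex   : ∀ x {φ} → NoDep φ → NoDep (ex x φ)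
  all  : ∀ x {φ} → NoDep φ → NoDep (all x φ)
  most : ∀ x {φ} → NoDep φ → NoDep (most x φ)

-- Finite structures: universe Fin (suc m) (non-empty, finite).

record Structure (τ : Vocabulary) : Set where
  field
    m    : ℕ
    funI : (f : FunSym τ) → Vec (Fin (suc m)) (funAr τ f) → Fin (suc m)
    relI : (R : RelSym τ) → Vec (Fin (suc m)) (relAr τ R) → Bool

card : ∀ {τ} → Structure τ → ℕ
card 𝔄 = suc (Structure.m 𝔄)

-- Assignments with domain {x₀,…,x_{d-1}} and teams (sets of assignments,
-- given by their characteristic function; the universe of assignments is finite).
Assignment : ℕ → ℕ → Set
Assignment N d = Vec (Fin N) d

Team : ℕ → ℕ → Set
Team N d = Assignment N d → Bool

-- all vectors (all functions Fin d → Fin N), without repetition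
allVecs : ∀ N d → List (Vec (Fin N) d)
allVecs N zero    = [] ∷ []
allVecs N (suc d) = L.concatMap (λ i → L.map (i ∷_) (allVecs N d)) (L.allFin N)

_==_ : ∀ {N d} → Assignment N d → Assignment N d → Bool
s == t = ⌊ ≡-dec F._≟_ s t ⌋

-- the elements of a team, listed without repetition
members : ∀ {N d} → Team N d → List (Assignment N d)
members {N} {d} X = L.filterᵇ X (allVecs N d)

size : ∀ {N d} → Team N d → ℕ
size X = length (members X)

fromList : ∀ {N d} → List (Assignment N d) → Team N d
fromList l t = anyᵇ (_== t) l

_⊆T_ : ∀ {N d} → Team N d → Team N d → Set
X' ⊆T X = ∀ s → X' s ≡ true → X s ≡ true

-- X(F/x), where F : X → A is given by its list of values on members X
supplement : ∀ {N d} → Fin d → (X : Team N d) → Vec (Fin N) (size X) → Team N d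
supplement x X v =
  fromList (V.toList (V.zipWith (λ s a → s V.[ x ]≔ a) (V.fromList (members X)) v))

duplicate : ∀ {N d} → Fin d → Team N d → Team N d
duplicate {N} x X =
  fromList (L.concatMap (λ s → L.map (λ a → s V.[ x ]≔ a) (L.allFin N)) (members X))

-- Splittings X = Y ∪ Z are given by a labelling of the members of X with
-- 0 (only in Y), 1 (only in Z), 2 (in both); every pair Y,Z with
-- Y ∪ Z = X arises this way.
inY inZ : Fin 3 → Bool
inY zero          = true
inY (suc zero)    = false
inY (suc (suc _)) = true
inZ zero          = false
inZ (suc zero)    = true
inZ (suc (suc _)) = true

part : ∀ {N d} → (Fin 3 → Bool) → (X : Team N d) → Vec (Fin 3) (size X) → Team N d
part p X lab =
  fromList (L.map proj₁ (L.filterᵇ (λ q → p (proj₂ q))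
    (V.toList (V.zip (V.fromList (members X)) lab))))

module Semantics {τ : Vocabulary} (𝔄 : Structure τ) where
  open Structure 𝔄

  N : ℕ
  N = suc m

  mutual
    eval : ∀ {d} → Assignment N d → Term τ d → Fin N
    eval s (var x)    = V.lookup s x
    eval s (app f ts) = funI f (evals s ts)

    evals : ∀ {d k} → Assignment N d → Vec (Term τ d) k → Vec (Fin N) k
    evals s []       = []
    evals s (t ∷ ts) = eval s t ∷ evals s ts

  agreeOn : ∀ {d} → List (Term τ d) → Assignment N d → Assignment N d → Bool
  agreeOn ts s s' = allᵇ (λ t → ⌊ eval s t F.≟ eval s' t ⌋) ts

  count : ∀ {A : Set} → (A → Bool) → List A → ℕ
  count p l = length (L.filterᵇ p l)

  sat : ∀ {d} → Formula τ d → Team N d → Bool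
  sat (eq t u)    X = allᵇ (λ s → ⌊ eval s t F.≟ eval s u ⌋) (members X)
  sat (neq t u)   X = allᵇ (λ s → not ⌊ eval s t F.≟ eval s u ⌋) (members X)
  sat (rel R ts)  X = allᵇ (λ s → relI R (evals s ts)) (members X)
  sat (nrel R ts) X = allᵇ (λ s → not (relI R (evals s ts))) (members X)
  sat (dep ts t)  X = allᵇ (λ s → allᵇ (λ s' →
                        not (agreeOn ts s s') ∨ ⌊ eval s t F.≟ eval s' t ⌋)
                        (members X)) (members X)
  sat (ndep ts t) X = L.null (members X)
  sat (and φ ψ)   X = sat φ X ∧ sat ψ X
  sat (or φ ψ)    X = anyᵇ (λ lab → sat φ (part inY X lab) ∧ sat ψ (part inZ X lab))
                        (allVecs 3 (size X))
  sat (ex x φ)    X = anyᵇ (λ v → sat φ (supplement x X v)) (allVecs N (size X))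
  sat (all x φ)   X = sat φ (duplicate x X)
  sat (most x φ)  X = N ^ size X ≤ᵇ 2 * count (λ v → sat φ (supplement x X v))
                                              (allVecs N (size X))

_⊨[_]_ : ∀ {τ d} (𝔄 : Structure τ) → Team (card 𝔄) d → Formula τ d → Set
𝔄 ⊨[ X ] φ = Semantics.sat 𝔄 φ X ≡ true

Coherent : ∀ {τ d} → ℕ → Formula τ d → Set
Coherent {τ} {d} k φ =
  ∀ (𝔄 : Structure τ) (X : Team (card 𝔄) d) →
    (𝔄 ⊨[ X ] φ) ⇔ (∀ (X' : Team (card 𝔄) d) → X' ⊆T X → size X' ≡ k → 𝔄 ⊨[ X' ] φ)

-- Take the vocabulary with one constant c, interpreted as the
-- first element 0 of the universe A, and φ = M x (x = c).  For a team X,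
-- exactly one supplementing function F : X → A makes x = c true in X(F/x),
-- namely the constant function 0; hence φ holds in X iff |A|^|X| ≤ 2.
-- Only the instances of this equivalence needed below are established,
-- each by evaluating the semantics.  So φ holds in every team of size 0, in every team of size 1 when |A| = 2,
-- but fails in a singleton team when |A| = 4 and in a two-element team when
-- |A| = 2.  This refutes k-coherence:
--   * k = 1: in the 2-element structure the full team (size 2) falsifies φ,
--     although all its 1-element subteams satisfy it;
--   * k ≠ 1: in the 4-element structure a singleton team falsifies φ, while
--     its k-element subteams (which have at most one element, hence exist
--     only for k = 0 and are then empty) all satisfy it.
module Submission where

open import Defs
open import Data.Nat using (ℕ; zero; suc; _≤_; z≤n; s≤s; _≤ᵇ_; _^_; _*_)
open import Data.Nat.Properties using (m≤n⇒m≤1+n; _≟_)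
open import Data.Product using (Σ; _×_; _,_)
open import Data.Bool using (Bool; true; false; T?)
open import Data.Fin using (Fin) renaming (zero to fz)
open import Data.List as L using (List; []; _∷_; length)
open import Data.List.Properties using (filter-none)
import Data.List.Relation.Unary.All as All
open import Data.Vec as V using ([]; _∷_)
open import Function using (_∘_)
open import Function.Bundles using (Equivalence)
open import Relation.Nullary using (¬_; yes; no)
open import Relation.Binary.PropositionalEquality using (_≡_; refl; sym; trans)

length-filterᵇ-mono : ∀ {A : Set} (p q : A → Bool) → (∀ a → p a ≡ true → q a ≡ true) →
                      ∀ l → length (L.filterᵇ p l) ≤ length (L.filterᵇ q l)
length-filterᵇ-mono p q p⇒q [] = z≤n
length-filterᵇ-mono p q p⇒q (a ∷ l) with p a in pa | q a in qa
... | true  | true  = s≤s (length-filterᵇ-mono p q p⇒q l)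
... | true  | false with () ← trans (sym (p⇒q a pa)) qa
... | false | true  = m≤n⇒m≤1+n (length-filterᵇ-mono p q p⇒q l)
... | false | false = length-filterᵇ-mono p q p⇒q l

size-⊆T : ∀ {N d} (X' X : Team N d) → X' ⊆T X → size X' ≤ size X
size-⊆T X' X sub = length-filterᵇ-mono X' X sub (allVecs _ _)

τc : Vocabulary
τc = record { funArities = 0 ∷ [] ; relArities = [] }

c : Term τc 1
c = app fz []

φ : Formula τc 1
φ = most fz (eq (var fz) c)

A : ℕ → Structure τc
A m = record { m = m ; funI = λ _ _ → fz ; relI = λ () }

module _ (m : ℕ) where
  open Semantics (A m)

  -- The truth value of φ in a team, as a function of its list of members;
  -- sat φ X unfolds to φ-on (members X).
  φ-on : List (Assignment N 1) → Bool
  φ-on l = N ^ length l ≤ᵇ 2 * count succeeds (allVecs N (length l))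
    where
    succeeds : V.Vec (Fin N) (length l) → Bool
    succeeds v = sat (eq (var fz) c)
      (fromList (V.toList (V.zipWith (λ s a → s V.[ fz ]≔ a) (V.fromList l) v)))

  -- φ holds in the empty team: the empty function is the only supplement,
  -- and it succeeds.
  φ-empty : (X : Team N 1) → size X ≡ 0 → sat φ X ≡ true
  φ-empty X = φ-on-nil (members X)
    where
    eq-on-empty : sat (eq (var fz) c) (fromList []) ≡ true
    eq-on-empty rewrite filter-none (T? ∘ (λ (_ : Assignment N 1) → false))
                          (All.universal (λ _ ()) (allVecs N 1)) = refl

    φ-on-nil : (l : List (Assignment N 1)) → length l ≡ 0 → φ-on l ≡ true
    φ-on-nil [] _ rewrite eq-on-empty = refl

-- Over the 2-element universe φ holds in every singleton team: |A|^1 = 2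
-- and the supplement F ≡ 0 succeeds.
φ-singleton₂ : (X : Team 2 1) → size X ≡ 1 → A 1 ⊨[ X ] φ
φ-singleton₂ X = φ-on-single (members X)
  where
  φ-on-single : (l : List (Assignment 2 1)) → length l ≡ 1 → φ-on 1 l ≡ true
  φ-on-single ((_ ∷ []) ∷ []) _ = refl

-- The full team over the 2-element universe (two members) falsifies φ,
-- since 2^2 > 2 · 1.
full₂ : Team 2 1
full₂ _ = true

φ-fails-full₂ : ¬ (A 1 ⊨[ full₂ ] φ)
φ-fails-full₂ ()

-- A singleton team over the 4-element universe falsifies φ, since 4^1 > 2 · 1.
single₄ : Team 4 1
single₄ = fromList ((fz ∷ []) ∷ [])

φ-fails-single₄ : ¬ (A 3 ⊨[ single₄ ] φ)
φ-fails-single₄ ()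

subteam-single₄ : (X' : Team 4 1) → X' ⊆T single₄ → ¬ size X' ≡ 1 → size X' ≡ 0
subteam-single₄ X' sub ≢1 with size X' | size-⊆T X' single₄ sub
... | zero  | _         = refl
... | suc _ | s≤s z≤n   with () ← ≢1 refl

proposition2p12 : Σ Vocabulary λ τ → Σ ℕ λ d → Σ (Formula τ d) λ φ →
    NoDep φ × (∀ (k : ℕ) → ¬ Coherent k φ)
proposition2p12 = τc , 1 , φ , most fz (eq _ _) , incoherent
  where
  incoherent : ∀ k → ¬ Coherent k φ
  incoherent k coh with k ≟ 1
  ... | yes refl = φ-fails-full₂
        (Equivalence.from (coh (A 1) full₂) (λ X' _ size≡1 → φ-singleton₂ X' size≡1))
  ... | no k≢1 = φ-fails-single₄
        (Equivalence.from (coh (A 3) single₄) (λ X' sub size≡k →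
          φ-empty 3 X' (subteam-single₄ X' sub (λ size≡1 → k≢1 (trans (sym size≡k) size≡1)))))
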